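{- Let $u,w\in S_{\mathbb{Z}}$ with $u\le_L w$. Then for all $j\in\mathbb{Z}$, $\Theta_j(u)\le\Theta_j(w)$ and $\theta_j(u)\le\theta_j(w)$.
   Context: $S_{\mathbb{Z}}$ is the group of bijections of $\mathbb{Z}$ fixing all but finitely many integers, with Coxeter length $\ell$ with respect to the simple transpositions $s_i=(i\ i+1)$. The left weak Bruhat order is defined by $u\le_L w$ iff $\ell(w)=\ell(wu^{ -1})+\ell(u)$. For $w\in S_{\mathbb{Z}}$ and $i\in\mathbb{Z}$: $\mathrm{code}(w)_i=|\{j>i: w(j)<w(i)\}|$, $\mathrm{dualcode}(w)_i=|\{j<i: w(j)>w(i)\}|$, $\theta_i(w)=1$ if $\mathrm{code}(w)_i>0$ and $0$ otherwise, $\Theta_i(w)=1$ if $\mathrm{dualcode}(w)_i>0$ and $0$ otherwise. -}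

module Defs where

open import Data.Nat as ℕ using (ℕ; zero; suc)
open import Data.Nat.Properties as ℕP using ()
open import Data.Integer as ℤ using (ℤ; +_; _+_; _-_; -_; ∣_∣; _<_; _<?_)
open import Data.List using (List; []; _∷_; map; filter; length; upTo; concatMap)
open import Relation.Binary.PropositionalEquality using (_≡_; refl; sym; trans; cong)

record SZ : Set where
  field
    fun   : ℤ → ℤ
    inv   : ℤ → ℤ
    inv-l : ∀ x → inv (fun x) ≡ x
    inv-r : ∀ x → fun (inv x) ≡ x
    bound : ℕ
    fixes : ∀ x → bound ℕ.< ∣ x ∣ → fun x ≡ x
open SZ public

private
  inv-fixes : (w : SZ) → ∀ x → bound w ℕ.< ∣ x ∣ → inv w x ≡ x
  inv-fixes w x p = trans (cong (inv w) (sym (fixes w x p))) (inv-l w x)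

_·_ : SZ → SZ → SZ
v · u = record
  { fun = λ x → fun v (fun u x)
  ; inv = λ x → inv u (inv v x)
  ; inv-l = λ x → trans (cong (inv u) (inv-l v (fun u x))) (inv-l u x)
  ; inv-r = λ x → trans (cong (fun v) (inv-r u (inv v x))) (inv-r v x)
  ; bound = bound v ℕ.⊔ bound u
  ; fixes = λ x p →
      trans (cong (fun v) (fixes u x (ℕP.≤-<-trans (ℕP.m≤n⊔m (bound v) (bound u)) p)))
            (fixes v x (ℕP.≤-<-trans (ℕP.m≤m⊔n (bound v) (bound u)) p))
  }

_⁻¹ : SZ → SZ
w ⁻¹ = record
  { fun = inv w ; inv = fun w ; inv-l = inv-r w ; inv-r = inv-l w
  ; bound = bound w ; fixes = inv-fixes w }

interval : ℤ → ℕ → List ℤ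
interval a n = map (λ k → a + + k) (upTo n)

window : ℕ → List ℤ
window N = interval (- + N) (suc (N ℕ.+ N))

-- Coxeter length = number of inversions {(i,j) : i < j, w(i) > w(j)};
-- all inversions lie in [-bound, bound].
ℓ : SZ → ℕ
ℓ w = length (filter (λ p → fun w (Pair.snd p) <? fun w (Pair.fst p))
                     (concatMap (λ i → map (λ j → mk i j) (filter (λ j → i <? j) W)) W))
  where
    W = window (bound w)
    record Pair : Set where
      constructor mk
      field fst snd : ℤ

_≤L_ : SZ → SZ → Set
u ≤L w = ℓ w ≡ ℓ (w · (u ⁻¹)) ℕ.+ ℓ u

-- code(w)_i = |{ j > i : w(j) < w(i) }|.
-- Every such j satisfies j ≤ bound, hence j ∈ [i+1, i+|i|+bound+1].
code : SZ → ℤ → ℕ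
code w i = length (filter (λ j → fun w j <? fun w i)
                          (interval (i + + 1) (suc (∣ i ∣ ℕ.+ bound w))))

-- dualcode(w)_i = |{ j < i : w(j) > w(i) }|.
-- Every such j satisfies j ≥ -bound, hence j ∈ [i-|i|-bound-1, i-1].
dualcode : SZ → ℤ → ℕ
dualcode w i = length (filter (λ j → fun w i <? fun w j)
                              (interval (i - + suc (∣ i ∣ ℕ.+ bound w)) (suc (∣ i ∣ ℕ.+ bound w))))

indicator : ℕ → ℕ
indicator zero    = 0
indicator (suc _) = 1

θ : ℤ → SZ → ℕ
θ i w = indicator (code w i)

Θ : ℤ → SZ → ℕ
Θ i w = indicator (dualcode w i)

{-# OPTIONS --safe #-}
module Submission where

-- If u ≤L w then every inversion of u is an inversion of w; θ j and Θ j only record whether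
-- j is the left or the right end of some inversion, so they can only grow.
-- For the inclusion, count pairs a < b in a window [-N, N] containing the supports of u and w.
-- With v = w u⁻¹, every pair on which u and w disagree yields the inversion {u a, u b} of v,
-- so the number D of disagreements is at most ℓ v. If S is the set of inversions of u that are
-- not inversions of w, then ℓ u + D = ℓ w + 2 |S|, and ℓ u + ℓ v = ℓ w forces |S| = 0.

open import Defs
open import Data.Nat using (_≤_)
open import Data.Integer using (ℤ)
open import Data.Product using (_×_)

import Data.Integer.Properties as ℤP
open import Algebra.Properties.AbelianGroup ℤP.+-0-abelianGroup using (∙-cancelˡ)
open import Data.Integer as ℤ
  using (+_; -[1+_]; _<?_; -_; _+_; _-_; _⊓_; _⊔_; ∣_∣; +≤+; -≤-; -≤+; +<+)
  renaming (_<_ to _<ℤ_; _≤_ to _≤ℤ_)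
open import Data.Integer.Tactic.RingSolver using (solve-∀)
open import Data.List using (List; []; _∷_; _++_; map; filter; length; concatMap; cartesianProduct)
import Data.List.Properties as List
open import Data.List.Membership.Propositional using (_∈_)
open import Data.List.Membership.Propositional.Properties
  using (∈-filter⁺; ∈-filter⁻; ∈-map⁺; ∈-map⁻; ∈-upTo⁺; ∈-upTo⁻;
         ∈-∃++; ∈-++⁺ˡ; ∈-++⁺ʳ; ∈-++⁻;
         ∈-length; ∈-cartesianProduct⁺; ∈-cartesianProduct⁻)
open import Data.List.Relation.Unary.Any using (here; there)
import Data.List.Relation.Unary.All as All
open import Data.List.Relation.Unary.Unique.Propositional using (Unique; _∷_)
import Data.List.Relation.Unary.Unique.Propositional.Properties as Unique
open import Data.Nat as ℕ using (ℕ; zero; suc; z≤n; s≤s; _<_; _*_)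
import Data.Nat.Properties as ℕP
open import Data.Nat.Tactic.RingSolver using () renaming (solve-∀ to solve-∀ℕ)
open import Data.Product using (∃; _,_; proj₁; proj₂; map₂)
open import Data.Sum using (_⊎_; inj₁; inj₂)
open import Function using (_∘_; _⇔_; mk⇔; Equivalence)
open import Level using (Level; 0ℓ)
open import Relation.Binary.PropositionalEquality
open import Relation.Nullary using (¬_; yes; no; contradiction)
open import Relation.Nullary.Decidable using (_×-dec_)
open import Relation.Unary using (Pred; Decidable; _⊆_; _∩_; _∪_; ∁)
open import Relation.Unary.Properties using (_∩?_; _∪?_; ∁?)

private variable
  a p q : Level
  A B : Set a

Unique-⊆⇒length≤ : {xs ys : List A} → Unique xs → (∀ {x} → x ∈ xs → x ∈ ys) → length xs ≤ length ys
Unique-⊆⇒length≤ {xs = []}     _                 _     = z≤n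
Unique-⊆⇒length≤ {xs = x ∷ xs} (x∉xs ∷ xs-unique) xs⊆ys
  with ys₁ , ys₂ , refl ← ∈-∃++ (xs⊆ys (here refl)) =
  subst (suc (length xs) ≤_) (sym length-ys) (s≤s (Unique-⊆⇒length≤ xs-unique xs⊆ys₁++ys₂))
  where
    length-ys : length (ys₁ ++ x ∷ ys₂) ≡ suc (length (ys₁ ++ ys₂))
    length-ys = trans (List.length-++ ys₁) (trans (ℕP.+-suc _ _) (cong suc (sym (List.length-++ ys₁))))
    xs⊆ys₁++ys₂ : ∀ {y} → y ∈ xs → y ∈ ys₁ ++ ys₂
    xs⊆ys₁++ys₂ y∈xs with ∈-++⁻ ys₁ (xs⊆ys (there y∈xs))
    ... | inj₁ y∈ys₁         = ∈-++⁺ˡ y∈ys₁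
    ... | inj₂ (here refl)   = contradiction refl (All.lookup x∉xs y∈xs)
    ... | inj₂ (there y∈ys₂) = ∈-++⁺ʳ ys₁ y∈ys₂

count : {P : Pred A p} → Decidable P → List A → ℕ
count P? xs = length (filter P? xs)

module _ {P : Pred A p} (P? : Decidable P) where

  count-mono : {xs ys : List A} → Unique xs → (∀ {x} → x ∈ xs → P x → x ∈ ys) →
               count P? xs ≤ count P? ys
  count-mono xs-unique sub = Unique-⊆⇒length≤ (Unique.filter⁺ P? xs-unique) λ x∈ →
    let x∈xs , px = ∈-filter⁻ P? x∈ in ∈-filter⁺ P? (sub x∈xs px) px

  count-++ : (xs ys : List A) → count P? (xs ++ ys) ≡ count P? xs ℕ.+ count P? ys
  count-++ xs ys = trans (cong length (List.filter-++ P? xs ys)) (List.length-++ (filter P? xs))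

  count-map : (f : B → A) (xs : List B) → count P? (map f xs) ≡ count (P? ∘ f) xs
  count-map f []       = refl
  count-map f (x ∷ xs) with P? (f x)
  ... | yes _ = cong suc (count-map f xs)
  ... | no  _ = count-map f xs

  count-pos⁺ : {x : A} {xs : List A} → x ∈ xs → P x → 0 < count P? xs
  count-pos⁺ x∈xs px = ∈-length (∈-filter⁺ P? x∈xs px)

  count-pos⁻ : (xs : List A) → 0 < count P? xs → ∃ λ x → x ∈ xs × P x
  count-pos⁻ (x ∷ xs) pos with P? x
  ... | yes px = x , here refl , px
  ... | no  _ with y , y∈xs , py ← count-pos⁻ xs pos = y , there y∈xs , py

module _ {P : Pred A p} {Q : Pred A q} (P? : Decidable P) (Q? : Decidable Q) where

  count-filter : (xs : List A) → count Q? (filter P? xs) ≡ count (P? ∩? Q?) xs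
  count-filter []       = refl
  count-filter (x ∷ xs) with P? x
  ... | no  _ = count-filter xs
  ... | yes _ with Q? x
  ...   | yes _ = cong suc (count-filter xs)
  ...   | no  _ = count-filter xs

  count-disagree : (xs : List A) →
    count P? xs ℕ.+ count ((P? ∩? ∁? Q?) ∪? (∁? P? ∩? Q?)) xs
      ≡ count Q? xs ℕ.+ 2 * count (P? ∩? ∁? Q?) xs
  count-disagree []       = refl
  count-disagree (x ∷ xs) with P? x | Q? x | count-disagree xs
  ... | yes _ | yes _ | ih = cong suc ih
  ... | yes _ | no  _ | ih = trans (ℕP.+-suc (suc _) _) (trans (cong (2 ℕ.+_) ih) (shift _ _))
    where
      shift : ∀ m n → 2 ℕ.+ (m ℕ.+ 2 * n) ≡ m ℕ.+ 2 * suc n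
      shift = solve-∀ℕ
  ... | no  _ | yes _ | ih = trans (ℕP.+-suc _ _) (cong suc ih)
  ... | no  _ | no  _ | ih = ih

∈-interval⁻ : ∀ {a n x} → x ∈ interval a n → a ≤ℤ x × x <ℤ a + + n
∈-interval⁻ {a} x∈ with k , k∈upTo , refl ← ∈-map⁻ (λ k → a + + k) x∈ =
  ℤP.i≤i+j a (+ k) , ℤP.+-monoʳ-< a (+<+ (∈-upTo⁻ k∈upTo))

∈-interval⁺ : ∀ {a n x} → a ≤ℤ x → x <ℤ a + + n → x ∈ interval a n
∈-interval⁺ {a} {n} {x} a≤x x<a+n =
  subst (_∈ interval a n) a+∣x-a∣≡x (∈-map⁺ (λ k → a + + k) (∈-upTo⁺ ∣x-a∣<n))
  where
    +∣x-a∣≡x-a : + ∣ x - a ∣ ≡ x - a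
    +∣x-a∣≡x-a = ℤP.0≤i⇒+∣i∣≡i (ℤP.i≤j⇒0≤j-i a≤x)
    a+∣x-a∣≡x : a + + ∣ x - a ∣ ≡ x
    a+∣x-a∣≡x = trans (cong (λ y → a + y) +∣x-a∣≡x-a) (a+[y-a]≡y a x)
      where
        a+[y-a]≡y : ∀ a y → a + (y - a) ≡ y
        a+[y-a]≡y = solve-∀
    ∣x-a∣<n : ∣ x - a ∣ ℕ.< n
    ∣x-a∣<n = ℤP.drop‿+<+
      (subst₂ _<ℤ_ (sym +∣x-a∣≡x-a) ([a+y]-a≡y a (+ n)) (ℤP.+-monoˡ-< (- a) x<a+n))
      where
        [a+y]-a≡y : ∀ a y → (a + y) - a ≡ y
        [a+y]-a≡y = solve-∀

interval-unique : ∀ a n → Unique (interval a n)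
interval-unique a n = Unique.map⁺ (ℤP.+-injective ∘ ∙-cancelˡ a _ _) (Unique.upTo⁺ n)

InWindow : ℕ → ℤ → Set
InWindow N x = - + N ≤ℤ x × x ≤ℤ + N

InWindow-mono : ∀ {M N x} → M ≤ N → InWindow M x → InWindow N x
InWindow-mono M≤N (lo , hi) = ℤP.≤-trans (ℤP.neg-mono-≤ (+≤+ M≤N)) lo , ℤP.≤-trans hi (+≤+ M≤N)

∣∣≤⇒InWindow : ∀ {N} x → ∣ x ∣ ≤ N → InWindow N x
∣∣≤⇒InWindow         (+ n)    n≤N       = ℤP.neg-≤-pos , +≤+ n≤N
∣∣≤⇒InWindow {suc N} -[1+ n ] (s≤s n≤N) = -≤- n≤N , -≤+

window-end : ∀ N → - + N + + suc (N ℕ.+ N) ≡ + suc N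
window-end N = trans (cong (λ y → - + N + y) (ℤP.pos-+ (suc N) N)) (regroup (+ N))
  where
    regroup : ∀ n → - n + ((+ 1 + n) + n) ≡ + 1 + n
    regroup = solve-∀

∈-window⁻ : ∀ {N x} → x ∈ window N → InWindow N x
∈-window⁻ {N} x∈ with lo , hi ← ∈-interval⁻ x∈ =
  lo , ℤP.i<j⇒i≤pred[j] (subst (_ <ℤ_) (window-end N) hi)

∈-window⁺ : ∀ {N x} → InWindow N x → x ∈ window N
∈-window⁺ {N} (lo , hi) = ∈-interval⁺ lo (subst (_ <ℤ_) (sym (window-end N)) (ℤP.i≤pred[j]⇒i<j hi))

window-unique : ∀ N → Unique (window N)
window-unique N = interval-unique (- + N) (suc (N ℕ.+ N))

fun-injective : (w : SZ) → ∀ {x y} → fun w x ≡ fun w y → x ≡ y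
fun-injective w {x} {y} wx≡wy = trans (sym (inv-l w x)) (trans (cong (inv w) wx≡wy) (inv-l w y))

InWindow⊎fixed : (w : SZ) (x : ℤ) → InWindow (bound w) x ⊎ fun w x ≡ x
InWindow⊎fixed w x with bound w ℕ.<? ∣ x ∣
... | yes b<∣x∣ = inj₂ (fixes w x b<∣x∣)
... | no  b≮∣x∣ = inj₁ (∣∣≤⇒InWindow x (ℕP.≮⇒≥ b≮∣x∣))

fun-InWindow : (w : SZ) → ∀ {N x} → bound w ≤ N → InWindow N x → InWindow N (fun w x)
fun-InWindow w {N} {x} b≤N x∈ with InWindow⊎fixed w x
... | inj₂ wx≡x = subst (InWindow N) (sym wx≡x) x∈
... | inj₁ _ with InWindow⊎fixed w (fun w x)
...   | inj₁ wx∈  = InWindow-mono b≤N wx∈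
...   | inj₂ wwx≡wx = subst (InWindow N) (sym (fun-injective w wwx≡wx)) x∈

Inversion : (ℤ → ℤ) → Pred (ℤ × ℤ) 0ℓ
Inversion f (i , j) = i <ℤ j × f j <ℤ f i

inversion? : (f : ℤ → ℤ) → Decidable (Inversion f)
inversion? f (i , j) = (i <? j) ×-dec (f j <? f i)

Inversion-InWindow : (w : SZ) → ∀ {i j} → Inversion (fun w) (i , j) →
  InWindow (bound w) i × InWindow (bound w) j
Inversion-InWindow w {i} {j} (i<j , wj<wi) with InWindow⊎fixed w i | InWindow⊎fixed w j
... | inj₁ i∈ | inj₁ j∈ = i∈ , j∈
... | inj₁ i∈@(lo , _) | inj₂ wj≡j =
  i∈ , ℤP.≤-trans lo (ℤP.<⇒≤ i<j) , ℤP.<⇒≤ (ℤP.<-≤-trans j<wi (proj₂ (fun-InWindow w ℕP.≤-refl i∈)))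
  where
    j<wi : j <ℤ fun w i
    j<wi = subst (_<ℤ fun w i) wj≡j wj<wi
... | inj₂ wi≡i | inj₁ j∈@(_ , hi) =
  (ℤP.<⇒≤ (ℤP.≤-<-trans (proj₁ (fun-InWindow w ℕP.≤-refl j∈)) wj<i) , ℤP.≤-trans (ℤP.<⇒≤ i<j) hi) , j∈
  where
    wj<i : fun w j <ℤ i
    wj<i = subst (fun w j <ℤ_) wi≡i wj<wi
... | inj₂ wi≡i | inj₂ wj≡j = contradiction (subst₂ _<ℤ_ wj≡j wi≡i wj<wi) (ℤP.<-asym i<j)

windowPairs : ℕ → List (ℤ × ℤ)
windowPairs N = cartesianProduct (window N) (window N)

windowPairs-unique : ∀ N → Unique (windowPairs N)
windowPairs-unique N = Unique.cartesianProduct⁺ (window-unique N) (window-unique N)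

∈-windowPairs⁺ : ∀ {N i j} → InWindow N i → InWindow N j → (i , j) ∈ windowPairs N
∈-windowPairs⁺ i∈ j∈ = ∈-cartesianProduct⁺ (∈-window⁺ i∈) (∈-window⁺ j∈)

∈-windowPairs⁻ : ∀ {N i j} → (i , j) ∈ windowPairs N → InWindow N i × InWindow N j
∈-windowPairs⁻ {N} q∈ with i∈ , j∈ ← ∈-cartesianProduct⁻ (window N) (window N) q∈ =
  ∈-window⁻ i∈ , ∈-window⁻ j∈

inversionCount : (ℤ → ℤ) → ℕ → ℕ
inversionCount f N = count (inversion? f) (windowPairs N)

-- Stated for an arbitrary pair constructor, since ℓ builds its pairs with a record local to Defs.
count-concatMap-<-pairs : {P : Pred A p} (P? : Decidable P) (pair : ℤ → ℤ → A) (V W : List ℤ) →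
  count P? (concatMap (λ i → map (pair i) (filter (i <?_) W)) V)
    ≡ count (λ (i , j) → (i <? j) ×-dec P? (pair i j)) (cartesianProduct V W)
count-concatMap-<-pairs P? pair []      W = refl
count-concatMap-<-pairs {A = A} {P = P} P? pair (i ∷ V) W = begin
  count P? (map (pair i) (filter (i <?_) W) ++ rest)
    ≡⟨ count-++ P? (map (pair i) (filter (i <?_) W)) rest ⟩
  count P? (map (pair i) (filter (i <?_) W)) ℕ.+ count P? rest
    ≡⟨ cong₂ ℕ._+_ (count-map P? (pair i) (filter (i <?_) W)) (count-concatMap-<-pairs P? pair V W) ⟩
  count (P? ∘ pair i) (filter (i <?_) W) ℕ.+ count R? (cartesianProduct V W)
    ≡⟨ cong (ℕ._+ count R? (cartesianProduct V W))
            (trans (count-filter (i <?_) (P? ∘ pair i) W) (sym (count-map R? (i ,_) W))) ⟩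
  count R? (map (i ,_) W) ℕ.+ count R? (cartesianProduct V W)
    ≡⟨ count-++ R? (map (i ,_) W) (cartesianProduct V W) ⟨
  count R? (cartesianProduct (i ∷ V) W) ∎
  where
    open ≡-Reasoning
    rest : List A
    rest = concatMap (λ i → map (pair i) (filter (i <?_) W)) V
    R? : Decidable (λ ((i , j) : ℤ × ℤ) → i <ℤ j × P (pair i j))
    R? (i , j) = (i <? j) ×-dec P? (pair i j)

ℓ≡inversionCount : (w : SZ) → ℓ w ≡ inversionCount (fun w) (bound w)
ℓ≡inversionCount w = count-concatMap-<-pairs _ _ (window (bound w)) (window (bound w))

inversionCount-window : (w : SZ) → ∀ {N} → bound w ≤ N → inversionCount (fun w) N ≡ ℓ w
inversionCount-window w {N} b≤N = begin
  inversionCount (fun w) N         ≡⟨ ℕP.≤-antisym (count-mono W? (windowPairs-unique N) shrink)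
                                                   (count-mono W? (windowPairs-unique (bound w)) enlarge) ⟩
  inversionCount (fun w) (bound w) ≡⟨ ℓ≡inversionCount w ⟨
  ℓ w                              ∎
  where
    open ≡-Reasoning
    W? : Decidable (Inversion (fun w))
    W? = inversion? (fun w)
    shrink : ∀ {q} → q ∈ windowPairs N → Inversion (fun w) q → q ∈ windowPairs (bound w)
    shrink _ wq = let i∈ , j∈ = Inversion-InWindow w wq in ∈-windowPairs⁺ i∈ j∈
    enlarge : ∀ {q} → q ∈ windowPairs (bound w) → Inversion (fun w) q → q ∈ windowPairs N
    enlarge q∈ _ = let i∈ , j∈ = ∈-windowPairs⁻ q∈ in
      ∈-windowPairs⁺ (InWindow-mono b≤N i∈) (InWindow-mono b≤N j∈)

ordered : ℤ × ℤ → ℤ × ℤ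
ordered (x , y) = x ⊓ y , x ⊔ y

ordered-< : ∀ {x y} → x <ℤ y → ordered (x , y) ≡ (x , y)
ordered-< x<y = cong₂ _,_ (ℤP.i≤j⇒i⊓j≡i (ℤP.<⇒≤ x<y)) (ℤP.i≤j⇒i⊔j≡j (ℤP.<⇒≤ x<y))

ordered-> : ∀ {x y} → x <ℤ y → ordered (y , x) ≡ (x , y)
ordered-> x<y = cong₂ _,_ (ℤP.i≥j⇒i⊓j≡j (ℤP.<⇒≤ x<y)) (ℤP.i≥j⇒i⊔j≡i (ℤP.<⇒≤ x<y))

fun-≯⇒< : (w : SZ) → ∀ {a b} → a ≢ b → ¬ fun w b <ℤ fun w a → fun w a <ℤ fun w b
fun-≯⇒< w a≢b wb≮wa = ℤP.≤∧≢⇒< (ℤP.≮⇒≥ wb≮wa) (a≢b ∘ fun-injective w)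

module _ (u w : SZ) where
  private
    v : SZ
    v = w · (u ⁻¹)
    N : ℕ
    N = bound v
    u≤N : bound u ≤ N
    u≤N = ℕP.m≤n⊔m (bound w) (bound u)
    w≤N : bound w ≤ N
    w≤N = ℕP.m≤m⊔n (bound w) (bound u)
    U? : Decidable (Inversion (fun u))
    U? = inversion? (fun u)
    W? : Decidable (Inversion (fun w))
    W? = inversion? (fun w)
    V? : Decidable (Inversion (fun v))
    V? = inversion? (fun v)

    Disagree : Pred (ℤ × ℤ) 0ℓ
    Disagree = (Inversion (fun u) ∩ ∁ (Inversion (fun w))) ∪ (∁ (Inversion (fun u)) ∩ Inversion (fun w))
    disagree? : Decidable Disagree
    disagree? = (U? ∩? ∁? W?) ∪? (∁? U? ∩? W?)

    -- Left inverse of (a , b) ↦ the inversion of v at {u a , u b}; it spares an injectivity argument.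
    pullback : ℤ × ℤ → ℤ × ℤ
    pullback (x , y) = ordered (inv u x , inv u y)

    pulledBackInversions : List (ℤ × ℤ)
    pulledBackInversions = map pullback (filter V? (windowPairs N))

    ordered∈pulledBackInversions : ∀ {x y} → InWindow N x → InWindow N y →
      fun u x <ℤ fun u y → fun w y <ℤ fun w x → ordered (x , y) ∈ pulledBackInversions
    ordered∈pulledBackInversions {x} {y} x∈ y∈ ux<uy wy<wx =
      subst (_∈ pulledBackInversions) (cong₂ (λ x y → ordered (x , y)) (inv-l u x) (inv-l u y))
        (∈-map⁺ pullback (∈-filter⁺ V? ux,uy∈ v-inversion))
      where
        ux,uy∈ : (fun u x , fun u y) ∈ windowPairs N
        ux,uy∈ = ∈-windowPairs⁺ (fun-InWindow u u≤N x∈) (fun-InWindow u u≤N y∈)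
        v-inversion : Inversion (fun v) (fun u x , fun u y)
        v-inversion = ux<uy , subst₂ _<ℤ_ (cong (fun w) (sym (inv-l u y))) (cong (fun w) (sym (inv-l u x))) wy<wx

    disagreements⊆pulledBackInversions : ∀ {q} → q ∈ filter disagree? (windowPairs N) →
                                         q ∈ pulledBackInversions
    disagreements⊆pulledBackInversions {a , b} q∈
      with q∈N , q-disagrees ← ∈-filter⁻ disagree? {xs = windowPairs N} q∈
      with a∈ , b∈ ← ∈-windowPairs⁻ {N} q∈N | q-disagrees
    ... | inj₁ ((a<b , ub<ua) , w-ordered) =
      subst (_∈ pulledBackInversions) (ordered-> a<b) (ordered∈pulledBackInversions b∈ a∈ ub<ua
        (fun-≯⇒< w (ℤP.<⇒≢ a<b) (λ wb<wa → w-ordered (a<b , wb<wa))))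
    ... | inj₂ (u-ordered , (a<b , wb<wa)) =
      subst (_∈ pulledBackInversions) (ordered-< a<b) (ordered∈pulledBackInversions a∈ b∈
        (fun-≯⇒< u (ℤP.<⇒≢ a<b) (λ ub<ua → u-ordered (a<b , ub<ua))) wb<wa)

    disagreements≤ℓ : count disagree? (windowPairs N) ≤ ℓ v
    disagreements≤ℓ = begin
      count disagree? (windowPairs N)
        ≤⟨ Unique-⊆⇒length≤ (Unique.filter⁺ disagree? (windowPairs-unique N))
                            disagreements⊆pulledBackInversions ⟩
      length pulledBackInversions
        ≡⟨ List.length-map pullback (filter V? (windowPairs N)) ⟩
      inversionCount (fun v) N
        ≡⟨ ℓ≡inversionCount v ⟨
      ℓ v ∎
      where open ℕP.≤-Reasoning

  ≤L⇒Inversion⊆ : u ≤L w → Inversion (fun u) ⊆ Inversion (fun w)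
  ≤L⇒Inversion⊆ u≤w {q} uq with W? q
  ... | yes wq = wq
  ... | no ¬wq =
    contradiction ℓw+2s≤ℓw (ℕP.<⇒≱ (ℕP.m<m+n (ℓ w) (ℕP.<-≤-trans s>0 (ℕP.m≤m+n s _))))
    where
      s : ℕ
      s = count (U? ∩? ∁? W?) (windowPairs N)
      s>0 : 0 < s
      s>0 = let i∈ , j∈ = Inversion-InWindow u uq in
        count-pos⁺ (U? ∩? ∁? W?) (∈-windowPairs⁺ (InWindow-mono u≤N i∈) (InWindow-mono u≤N j∈))
                   (uq , ¬wq)
      ℓw+2s≤ℓw : ℓ w ℕ.+ 2 * s ≤ ℓ w
      ℓw+2s≤ℓw = begin
        ℓ w ℕ.+ 2 * s
          ≡⟨ cong (ℕ._+ 2 * s) (inversionCount-window w w≤N) ⟨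
        inversionCount (fun w) N ℕ.+ 2 * s
          ≡⟨ count-disagree U? W? (windowPairs N) ⟨
        inversionCount (fun u) N ℕ.+ count disagree? (windowPairs N)
          ≤⟨ ℕP.+-mono-≤ (ℕP.≤-reflexive (inversionCount-window u u≤N)) disagreements≤ℓ ⟩
        ℓ u ℕ.+ ℓ v
          ≡⟨ trans (ℕP.+-comm (ℓ u) (ℓ v)) (sym u≤w) ⟩
        ℓ w ∎
        where open ℕP.≤-Reasoning

i≤∣i∣ : ∀ i → i ≤ℤ + ∣ i ∣
i≤∣i∣ (+ n)    = ℤP.≤-refl
i≤∣i∣ -[1+ n ] = -≤+

-∣i∣≤i : ∀ i → - + ∣ i ∣ ≤ℤ i
-∣i∣≤i (+ n)    = ℤP.neg-≤-pos
-∣i∣≤i -[1+ n ] = ℤP.≤-refl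

code-interval-end : ∀ i b → + b <ℤ (i + + 1) + + suc (∣ i ∣ ℕ.+ b)
code-interval-end i b = begin-strict
  + b                                       <⟨ +<+ (ℕP.m<n+m b (s≤s z≤n)) ⟩
  + 2 + + b                                 ≡⟨ regroup (+ ∣ i ∣) (+ b) ⟩
  (- + ∣ i ∣ + + 1) + + suc (∣ i ∣ ℕ.+ b)   ≤⟨ ℤP.+-monoˡ-≤ _ (ℤP.+-monoˡ-≤ (+ 1) (-∣i∣≤i i)) ⟩
  (i + + 1) + + suc (∣ i ∣ ℕ.+ b)           ∎
  where
    open ℤP.≤-Reasoning
    regroup : ∀ m b → + 2 + b ≡ (- m + + 1) + (+ 1 + (m + b))
    regroup = solve-∀

dualcode-interval-start : ∀ i b → i - + suc (∣ i ∣ ℕ.+ b) ≤ℤ - + b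
dualcode-interval-start i b = begin
  i - + suc (∣ i ∣ ℕ.+ b)           ≤⟨ ℤP.+-monoˡ-≤ _ (i≤∣i∣ i) ⟩
  + ∣ i ∣ - + suc (∣ i ∣ ℕ.+ b)     ≡⟨ regroup (+ ∣ i ∣) (+ b) ⟩
  ℤ.pred (- + b)                    ≤⟨ ℤP.i≤j⇒pred[i]≤j ℤP.≤-refl ⟩
  - + b                             ∎
  where
    open ℤP.≤-Reasoning
    regroup : ∀ m b → m - (+ 1 + (m + b)) ≡ - + 1 + - b
    regroup = solve-∀

code-pos⇔ : (w : SZ) (i : ℤ) → 0 < code w i ⇔ ∃ λ j → Inversion (fun w) (i , j)
code-pos⇔ w i = mk⇔ to from
  where
    s : ℕ
    s = suc (∣ i ∣ ℕ.+ bound w)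
    to : 0 < code w i → ∃ λ j → Inversion (fun w) (i , j)
    to pos with j , j∈ , wj<wi ← count-pos⁻ (λ j → fun w j <? fun w i) (interval (i + + 1) s) pos =
      j , ℤP.suc[i]≤j⇒i<j (subst (_≤ℤ j) (ℤP.+-comm i (+ 1)) (proj₁ (∈-interval⁻ j∈))) , wj<wi
    from : (∃ λ j → Inversion (fun w) (i , j)) → 0 < code w i
    from (j , i,j-inversion@(i<j , wj<wi)) = count-pos⁺ (λ j → fun w j <? fun w i)
      (∈-interval⁺ (subst (_≤ℤ j) (ℤP.+-comm (+ 1) i) (ℤP.i<j⇒suc[i]≤j i<j))
                   (ℤP.≤-<-trans (proj₂ (proj₂ (Inversion-InWindow w i,j-inversion)))
                                 (code-interval-end i (bound w))))
      wj<wi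

dualcode-pos⇔ : (w : SZ) (i : ℤ) → 0 < dualcode w i ⇔ ∃ λ j → Inversion (fun w) (j , i)
dualcode-pos⇔ w i = mk⇔ to from
  where
    s : ℕ
    s = suc (∣ i ∣ ℕ.+ bound w)
    [i-s]+s≡i : ∀ i s → (i - s) + s ≡ i
    [i-s]+s≡i = solve-∀
    to : 0 < dualcode w i → ∃ λ j → Inversion (fun w) (j , i)
    to pos with j , j∈ , wi<wj ← count-pos⁻ (λ j → fun w i <? fun w j) (interval (i - + s) s) pos =
      j , subst (j <ℤ_) ([i-s]+s≡i i (+ s)) (proj₂ (∈-interval⁻ {i - + s} j∈)) , wi<wj
    from : (∃ λ j → Inversion (fun w) (j , i)) → 0 < dualcode w i
    from (j , j,i-inversion@(j<i , wi<wj)) = count-pos⁺ (λ j → fun w i <? fun w j)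
      (∈-interval⁺ (ℤP.≤-trans (dualcode-interval-start i (bound w))
                              (proj₁ (proj₁ (Inversion-InWindow w j,i-inversion))))
                   (subst (j <ℤ_) (sym ([i-s]+s≡i i (+ s))) j<i))
      wi<wj

indicator-mono : ∀ {m n} → (0 < m → 0 < n) → indicator m ≤ indicator n
indicator-mono {zero}          _       = z≤n
indicator-mono {suc m} {zero}  pos⇒pos = contradiction (pos⇒pos (s≤s z≤n)) λ ()
indicator-mono {suc m} {suc n} _       = s≤s z≤n

lemma2 : (u w : SZ) → u ≤L w → (j : ℤ) → (Θ j u ≤ Θ j w) × (θ j u ≤ θ j w)
lemma2 u w u≤w j =
  indicator-mono (from (dualcode-pos⇔ w j) ∘ map₂ inversion-preserved ∘ to (dualcode-pos⇔ u j)) ,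
  indicator-mono (from (code-pos⇔ w j) ∘ map₂ inversion-preserved ∘ to (code-pos⇔ u j))
  where
    open Equivalence
    inversion-preserved : Inversion (fun u) ⊆ Inversion (fun w)
    inversion-preserved = ≤L⇒Inversion⊆ u w u≤w
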